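{- Let $\mathcal{G}=(G,\theta)$ be a valued digraph. Then the poset $(IS(\mathcal{G}),\subseteq)$ is a graded complete meet semi-lattice, with rank function $\rho:A\mapsto |A|$. Moreover, if $G$ is finite, then $(IS(\mathcal{G}),\subseteq)$ is a complete lattice.
   Context: A simple digraph is a pair $G=(V,E)$ with $E\subseteq V\times V$; it is acyclic if there is no finite sequence $x_1,\dots,x_m$ of vertices with $(x_i,x_{i+1})\in E$ for all $i$ (indices mod $m$). The out-degree of $x$ is $d^+(x)=|\{y:(x,y)\in E\}|$ (possibly infinite). A valued digraph is a pair $\mathcal{G}=(G,\theta)$ where $G$ is a simple acyclic digraph and $\theta:V\to\mathbb{N}$ satisfies $0\le\theta(x)\le d^+(x)$ for all $x$. A vertex $x$ is erasable in $\mathcal{G}$ if $\theta(x)=0$ and every $z$ with $(z,x)\in E$ has $\theta(z)\neq0$. Peeling process: set $\mathcal{G}_1=\mathcal{G}$; if $\mathcal{G}_i=(G_i,\theta_i)$ has no erasable vertex, stop; otherwise choose an erasable vertex $x_i$ of $\mathcal{G}_i$, let $G_{i+1}$ be $G_i$ with $x_i$ and all arcs incident to it removed, and let $\theta_{i+1}(y)=\theta_i(y)-1$ if $(y,x_i)$ is an arc of $G_i$ and $\theta_{i+1}(y)=\theta_i(y)$ otherwise; iterate. Any resulting sequence $[x_1,x_2,\dots]$ (finite or infinite) is a peeling sequence of $\mathcal{G}$. An initial section of a peeling sequence $[x_1,x_2,\dots]$ is a set $\{x_1,\dots,x_k\}$ with $k\ge1$, or $\emptyset$. $IS(\mathcal{G})$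 denotes the set of all initial sections of all peeling sequences of $\mathcal{G}$. A poset is a complete meet semi-lattice if every subset has an infimum; a complete lattice if every subset has both an infimum and a supremum. -}

module Defs where

open import Level using (Level; 0ℓ) renaming (suc to lsuc)
open import Data.Nat using (ℕ; zero; suc; _<_; _≤_; _∸_)
open import Data.Fin using (Fin)
open import Data.List using (List; []; _∷_; _++_; [_]; take; length; applyUpTo)
open import Data.List.Membership.Propositional using (_∈_; _∉_)
open import Data.List.Relation.Unary.Unique.Propositional using (Unique)
open import Data.Product using (Σ; _×_; _,_)
open import Relation.Nullary using (¬_)
open import Relation.Unary using (Pred; _⊆_; _≐_)
open import Relation.Binary.PropositionalEquality using (_≡_; _≢_)
open import Function.Definitions using (Injective)
open import Function.Bundles using (_↔_)

module _ {V : Set} where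

  _⊂_ : Pred V 0ℓ → Pred V 0ℓ → Set
  A ⊂ B = A ⊆ B × ¬ (B ⊆ A)

  SubsetOf : Pred (Pred V 0ℓ) 0ℓ → Pred (Pred V 0ℓ) (lsuc 0ℓ) → Set₁
  SubsetOf P S = ∀ A → S A → P A

  IsLowerBound : Pred (Pred V 0ℓ) 0ℓ → Pred (Pred V 0ℓ) (lsuc 0ℓ) → Pred V 0ℓ → Set₁
  IsLowerBound P S L = P L × (∀ A → S A → L ⊆ A)

  IsUpperBound : Pred (Pred V 0ℓ) 0ℓ → Pred (Pred V 0ℓ) (lsuc 0ℓ) → Pred V 0ℓ → Set₁
  IsUpperBound P S U = P U × (∀ A → S A → A ⊆ U)

  IsInfimum : Pred (Pred V 0ℓ) 0ℓ → Pred (Pred V 0ℓ) (lsuc 0ℓ) → Pred V 0ℓ → Set₁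
  IsInfimum P S M = IsLowerBound P S M × (∀ L → IsLowerBound P S L → L ⊆ M)

  IsSupremum : Pred (Pred V 0ℓ) 0ℓ → Pred (Pred V 0ℓ) (lsuc 0ℓ) → Pred V 0ℓ → Set₁
  IsSupremum P S M = IsUpperBound P S M × (∀ U → IsUpperBound P S U → M ⊆ U)

  CompleteMeetSemilattice : Pred (Pred V 0ℓ) 0ℓ → Set₂
  CompleteMeetSemilattice P =
    ∀ (S : Pred (Pred V 0ℓ) (lsuc 0ℓ)) → SubsetOf P S →
    Σ (Pred V 0ℓ) S → Σ (Pred V 0ℓ) (IsInfimum P S)

  CompleteLattice : Pred (Pred V 0ℓ) 0ℓ → Set₂
  CompleteLattice P =
    ∀ (S : Pred (Pred V 0ℓ) (lsuc 0ℓ)) → SubsetOf P S →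
    Σ (Pred V 0ℓ) (IsInfimum P S) × Σ (Pred V 0ℓ) (IsSupremum P S)

  HasSize : Pred V 0ℓ → ℕ → Set
  HasSize A n = Σ (List V) λ l → Unique l × length l ≡ n × (A ≐ λ x → x ∈ l)

  Covers : Pred (Pred V 0ℓ) 0ℓ → Pred V 0ℓ → Pred V 0ℓ → Set₁
  Covers P A B = P A × P B × A ⊂ B × (∀ C → P C → A ⊂ C → ¬ (C ⊂ B))

  GradedByCardinality : Pred (Pred V 0ℓ) 0ℓ → Set₁
  GradedByCardinality P =
    (∀ A → P A → Σ ℕ (HasSize A)) ×
    (∀ A B a b → P A → P B → A ⊂ B → HasSize A a → HasSize B b → a < b) ×
    (∀ A B a b → Covers P A B → HasSize A a → HasSize B b → b ≡ suc a)

module _ {V : Set} (E : V → V → Set) where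

  -- no finite cyclic sequence x_1..x_m (m ≥ 1): here f 0, …, f m with
  -- arcs f i → f (i+1) for i ≤ m and f (m+1) = f 0
  Acyclic : Set
  Acyclic = ∀ (m : ℕ) (f : ℕ → V) → (∀ i → i ≤ m → E (f i) (f (suc i))) → f (suc m) ≢ f 0

  _≤OutDeg_ : ℕ → V → Set
  n ≤OutDeg x = Σ (Fin n → V) λ g → Injective _≡_ _≡_ g × (∀ i → E x (g i))

  IsValuedDigraph : (V → ℕ) → Set
  IsValuedDigraph θ = Acyclic × (∀ x → θ x ≤OutDeg x)

  -- State of the peeling process after removing the list xs (in order):
  -- G_i = G minus xs; t is θ_i (its values on removed vertices are irrelevant).
  Erasable : List V → (V → ℕ) → V → Set
  Erasable xs t x = x ∉ xs × t x ≡ 0 × (∀ z → z ∉ xs → E z x → t z ≢ 0)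

  Update : List V → (V → ℕ) → V → (V → ℕ) → Set
  Update xs t x t' = ∀ y → ((y ∉ xs × E y x) → t' y ≡ t y ∸ 1)
                         × (¬ (y ∉ xs × E y x) → t' y ≡ t y)

  data Run (θ : V → ℕ) : List V → (V → ℕ) → Set where
    start : Run θ [] θ
    step  : ∀ {xs t x t'} → Run θ xs t → Erasable xs t x → Update xs t x t' →
            Run θ (xs ++ [ x ]) t'

  data PeelingSequence (θ : V → ℕ) : Set where
    finite   : (xs : List V) (t : V → ℕ) → Run θ xs t → (∀ x → ¬ Erasable xs t x) →
               PeelingSequence θ
    infinite : (s : ℕ → V) → (∀ k → Σ (V → ℕ) (Run θ (applyUpTo s k))) →
               PeelingSequence θ

  InitialSection : {θ : V → ℕ} → PeelingSequence θ → Pred V 0ℓ → Set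
  InitialSection (finite xs _ _ _) A = Σ ℕ λ k → k ≤ length xs × (A ≐ λ x → x ∈ take k xs)
  InitialSection (infinite s _)    A = Σ ℕ λ k → (A ≐ λ x → x ∈ applyUpTo s k)

  IS : (θ : V → ℕ) → Pred (Pred V 0ℓ) 0ℓ
  IS θ A = Σ (PeelingSequence θ) λ p → InitialSection p A

FiniteType : Set → Set
FiniteType V = Σ ℕ λ n → V ↔ Fin n

module Submission where

-- Initial sections are characterised intrinsically.  Call a duplicate-free vertex list l
-- admissible when every listed x has at least θ(x) out-neighbours in l and every unlisted
-- z at most θ(z).  Along a run θᵢ(z) = θ(z) − |N⁺(z) ∩ removed|, so vertex lists of runs
-- are admissible.  Conversely (growth lemma) a run inside an admissible B can erase a
-- vertex of B next: a source among the "ready" vertices of B (θ used up), which exist since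
-- a sink of the unremoved part of B is ready.  So admissible lists are vertex sets of runs,
-- and these are exactly the initial sections of finite or infinite peeling sequences.
--
-- The rank is the cardinality, and a cover adds one vertex by the growth lemma.  Joins:
-- from the union of a family inside an admissible K, keep adding vertices of K with too many
-- out-neighbours present; the result is admissible and is the least upper bound.  Infima are
-- joins of lower bounds, bounded by a member of the (nonempty) family, or by all of V when V
-- is finite.

open import Defs
open import Level using (Level; 0ℓ) renaming (suc to lsuc)
open import Data.Nat using (ℕ; zero; suc; _+_; _∸_; _≤_; _<_; z≤n; s≤s; _≤?_)
open import Data.Nat.Properties
open import Data.List using (List; []; _∷_; _++_; [_]; length; filter; take; applyUpTo; tabulate)
open import Data.List.Properties
  using (length-++; length-++-≤ˡ; length-++-sucʳ; length-tabulate; filter-++; filter-accept;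
         filter-reject; take-all; applyUpTo-∷ʳ; length-applyUpTo; ++-assoc; ++-identityʳ)
open import Data.List.Membership.Propositional using (_∈_; _∉_)
open import Data.List.Membership.Propositional.Properties
  using (∈-++⁺ˡ; ∈-++⁺ʳ; ∈-++⁻; ∈-∃++; ∈-filter⁺; ∈-filter⁻; ∈-tabulate⁺; ∈-tabulate⁻; ∈-applyUpTo⁻)
open import Data.List.Relation.Binary.Subset.Propositional using () renaming (_⊆_ to _⊆ₗ_)
open import Data.List.Relation.Unary.Any using (here; there)
open import Data.List.Relation.Unary.All as All using (All; [])
open import Data.List.Relation.Unary.All.Properties using (¬Any⇒All¬; applyUpTo⁺₁)
open import Data.List.Relation.Unary.AllPairs using ([]; _∷_)
open import Data.List.Relation.Unary.Unique.Propositional using (Unique)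
import Data.List.Relation.Unary.Unique.Propositional.Properties as Unique
open import Data.Product using (Σ; _×_; _,_; proj₁; proj₂)
open import Data.Sum using (_⊎_; inj₁; inj₂)
open import Data.Empty using (⊥-elim)
open import Function using (_∘_; flip)
open import Function.Bundles using (Inverse)
open import Relation.Nullary using (¬_; yes; no)
open import Relation.Nullary.Decidable using (decidable-stable)
open import Relation.Unary using (Pred; _⊆_; _≐_; Decidable)
open import Relation.Binary.PropositionalEquality using (_≡_; _≢_; refl; sym; trans; cong; subst; module ≡-Reasoning)
open import Axiom.ExcludedMiddle using (ExcludedMiddle)

module ListFacts {A : Set} where

  ∈-delete : ∀ {x y : A} ys zs → y ∈ ys ++ x ∷ zs → x ≢ y → y ∈ ys ++ zs
  ∈-delete ys zs y∈ x≢y with ∈-++⁻ ys y∈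
  ... | inj₁ p = ∈-++⁺ˡ p
  ... | inj₂ (here refl) = ⊥-elim (x≢y refl)
  ... | inj₂ (there p) = ∈-++⁺ʳ ys p

  ⊆-length : (l₁ l₂ : List A) → Unique l₁ → l₁ ⊆ₗ l₂ → length l₁ ≤ length l₂
  ⊆-length [] l₂ _ _ = z≤n
  ⊆-length (x ∷ l₁) l₂ (x∉l₁ ∷ u) sub with ∈-∃++ (sub (here refl))
  ... | ys , zs , refl =
    subst (suc (length l₁) ≤_) (sym (length-++-sucʳ ys x zs))
      (s≤s (⊆-length l₁ (ys ++ zs) u (λ p → ∈-delete ys zs (sub (there p)) (All.lookup x∉l₁ p))))

  ⊆-length-< : ∀ {y} (l₁ l₂ : List A) → Unique l₁ → l₁ ⊆ₗ l₂ → y ∈ l₂ → y ∉ l₁ →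
               length l₁ < length l₂
  ⊆-length-< {y} l₁ l₂ u sub y∈l₂ y∉l₁ =
    ⊆-length (y ∷ l₁) l₂ (¬Any⇒All¬ l₁ y∉l₁ ∷ u) λ { (here refl) → y∈l₂ ; (there p) → sub p }

  same-members-length : (l₁ l₂ : List A) → Unique l₁ → Unique l₂ → l₁ ⊆ₗ l₂ → l₂ ⊆ₗ l₁ →
                        length l₁ ≡ length l₂
  same-members-length l₁ l₂ u₁ u₂ s₁ s₂ = ≤-antisym (⊆-length l₁ l₂ u₁ s₁) (⊆-length l₂ l₁ u₂ s₂)

  take-++ˡ : ∀ (l w : List A) k → k ≤ length l → take k (l ++ w) ≡ take k l
  take-++ˡ l w zero _ = refl
  take-++ˡ (x ∷ l) w (suc k) (s≤s k≤) = cong (x ∷_) (take-++ˡ l w k k≤)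

  take-length-++ : ∀ (l w : List A) → take (length l) (l ++ w) ≡ l
  take-length-++ l w = trans (take-++ˡ l w (length l) ≤-refl) (take-all (length l) l ≤-refl)

  take-applyUpTo : ∀ (f : ℕ → A) k m → take k (applyUpTo f (k + m)) ≡ applyUpTo f k
  take-applyUpTo f zero m = refl
  take-applyUpTo f (suc k) m = cong (f 0 ∷_) (take-applyUpTo (f ∘ suc) k m)

  _▹_ : List A → (ℕ → A) → ℕ → A
  ([] ▹ f) i = f i
  ((x ∷ xs) ▹ f) zero = x
  ((x ∷ xs) ▹ f) (suc i) = (xs ▹ f) i

  applyUpTo-▹ : ∀ xs (f : ℕ → A) n → applyUpTo (xs ▹ f) (length xs + n) ≡ xs ++ applyUpTo f n
  applyUpTo-▹ [] f n = refl
  applyUpTo-▹ (x ∷ xs) f n = cong (x ∷_) (applyUpTo-▹ xs f n)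

  applyUpTo-unique : (f : ℕ → A) → (∀ i k → f i ≢ f (i + suc k)) → ∀ n → Unique (applyUpTo f n)
  applyUpTo-unique f distinct zero = []
  applyUpTo-unique f distinct (suc n) =
    applyUpTo⁺₁ (f ∘ suc) n (λ {k} _ → distinct 0 k) ∷
    applyUpTo-unique (f ∘ suc) (λ i k → distinct (suc i) k) n

  iterate-snoc : (Q : List A → Set) → Q [] → (∀ l → Q l → Σ A λ x → Q (l ++ [ x ])) →
                 Σ (ℕ → A) λ f → ∀ n → Q (applyUpTo f n)
  iterate-snoc Q q₀ extend = f , λ n → subst Q (walk-prefix n) (proj₂ (walk n))
    where
      walk : ℕ → Σ (List A) Q
      walk zero = [] , q₀
      walk (suc n) = let (x , q) = extend (proj₁ (walk n)) (proj₂ (walk n)) in proj₁ (walk n) ++ [ x ] , q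
      f : ℕ → A
      f n = proj₁ (extend (proj₁ (walk n)) (proj₂ (walk n)))
      walk-prefix : ∀ n → proj₁ (walk n) ≡ applyUpTo f n
      walk-prefix zero = refl
      walk-prefix (suc n) = trans (cong (_++ [ f n ]) (walk-prefix n)) (applyUpTo-∷ʳ f n)

open ListFacts

module Acyclicity {V : Set} (R : V → V → Set) where

  acyclic-flip : Acyclic R → Acyclic (flip R)
  acyclic-flip acyclic m f arcs f-closes =
    acyclic m (λ i → f (suc m ∸ i)) backwards (trans (cong f (n∸n≡0 m)) (sym f-closes))
    where
      backwards : ∀ j → j ≤ m → R (f (suc m ∸ j)) (f (m ∸ j))
      backwards j j≤m =
        subst (λ a → R (f a) (f (m ∸ j))) (sym (+-∸-assoc 1 j≤m)) (arcs (m ∸ j) (m∸n≤m m j))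

  walk-injective : Acyclic R → (w : ℕ → V) → (∀ n → R (w n) (w (suc n))) →
                   ∀ i k → w i ≢ w (i + suc k)
  walk-injective acyclic w arcs i k revisit =
    acyclic k (λ n → w (i + n)) (λ j _ → subst (R (w (i + j)) ∘ w) (sym (+-suc i j)) (arcs (i + j)))
      (trans (sym revisit) (cong w (sym (+-identityʳ i))))

  -- Every nonempty finite set of vertices contains a sink of the induced subgraph;
  -- otherwise a walk inside it would be longer than the set.
  sink : ExcludedMiddle 0ℓ → Acyclic R → (D : List V) → ∀ {d} → d ∈ D →
         Σ V λ s → s ∈ D × (∀ {y} → y ∈ D → ¬ R s y)
  sink em acyclic D {d} d∈D with em {Σ V λ s → s ∈ D × (∀ {y} → y ∈ D → ¬ R s y)}
  ... | yes found = found
  ... | no none = ⊥-elim (<-irrefl refl too-long)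
    where
      next : (x : V) → x ∈ D → Σ V λ y → y ∈ D × R x y
      next x x∈D with em {Σ V λ y → y ∈ D × R x y}
      ... | yes y = y
      ... | no ¬y = ⊥-elim (none (x , x∈D , λ y∈D r → ¬y (_ , y∈D , r)))
      walk : ℕ → Σ V (_∈ D)
      walk zero = d , d∈D
      walk (suc n) = proj₁ (next (proj₁ (walk n)) (proj₂ (walk n))) ,
                     proj₁ (proj₂ (next (proj₁ (walk n)) (proj₂ (walk n))))
      w : ℕ → V
      w n = proj₁ (walk n)
      arcs : ∀ n → R (w n) (w (suc n))
      arcs n = proj₂ (proj₂ (next (w n) (proj₂ (walk n))))
      too-long : suc (length D) ≤ length D
      too-long = subst (_≤ length D) (length-applyUpTo w (suc (length D)))
        (⊆-length (applyUpTo w (suc (length D))) D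
          (applyUpTo-unique w (walk-injective acyclic w arcs) (suc (length D)))
          (λ p → let (i , _ , eq) = ∈-applyUpTo⁻ w p in subst (_∈ D) (sym eq) (proj₂ (walk i))))

open Acyclicity

module Peeling {V : Set} (E : V → V → Set) (θ : V → ℕ) (valued : IsValuedDigraph E θ)
               (lem : (ℓ : Level) → ExcludedMiddle ℓ) where

  em : ExcludedMiddle 0ℓ
  em = lem 0ℓ

  acyclic : Acyclic E
  acyclic = proj₁ valued

  ⊆-or-missing : (P Q : Pred V 0ℓ) → P ⊆ Q ⊎ Σ V λ v → P v × ¬ Q v
  ⊆-or-missing P Q with em {Σ V λ v → P v × ¬ Q v}
  ... | yes m = inj₂ m
  ... | no ¬m = inj₁ λ {v} Pv → decidable-stable em (λ ¬Qv → ¬m (v , Pv , ¬Qv))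

  missing : {P Q : Pred V 0ℓ} → ¬ (P ⊆ Q) → Σ V λ v → P v × ¬ Q v
  missing {P} {Q} P⊈Q with ⊆-or-missing P Q
  ... | inj₁ P⊆Q = ⊥-elim (P⊈Q P⊆Q)
  ... | inj₂ m = m

  arc? : (z : V) → Decidable (E z)
  arc? z x = em

  deg⁺ : V → List V → ℕ
  deg⁺ z l = length (filter (arc? z) l)

  deg⁺-++ : ∀ z l m → deg⁺ z (l ++ m) ≡ deg⁺ z l + deg⁺ z m
  deg⁺-++ z l m = trans (cong length (filter-++ (arc? z) l m)) (length-++ (filter (arc? z) l))

  deg⁺-snoc-arc : ∀ {z x} xs → E z x → deg⁺ z (xs ++ [ x ]) ≡ suc (deg⁺ z xs)
  deg⁺-snoc-arc {z} xs e = begin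
    deg⁺ z (xs ++ [ _ ])     ≡⟨ deg⁺-++ z xs [ _ ] ⟩
    deg⁺ z xs + deg⁺ z [ _ ] ≡⟨ cong (λ n → deg⁺ z xs + length n) (filter-accept (arc? z) e) ⟩
    deg⁺ z xs + 1            ≡⟨ +-comm (deg⁺ z xs) 1 ⟩
    suc (deg⁺ z xs)          ∎
    where open ≡-Reasoning

  deg⁺-snoc-nonarc : ∀ {z x} xs → ¬ E z x → deg⁺ z (xs ++ [ x ]) ≡ deg⁺ z xs
  deg⁺-snoc-nonarc {z} xs ¬e = begin
    deg⁺ z (xs ++ [ _ ])     ≡⟨ deg⁺-++ z xs [ _ ] ⟩
    deg⁺ z xs + deg⁺ z [ _ ] ≡⟨ cong (λ n → deg⁺ z xs + length n) (filter-reject (arc? z) ¬e) ⟩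
    deg⁺ z xs + 0            ≡⟨ +-identityʳ (deg⁺ z xs) ⟩
    deg⁺ z xs                ∎
    where open ≡-Reasoning

  deg⁺-snoc-≤ : ∀ {z} xs x → deg⁺ z xs ≤ deg⁺ z (xs ++ [ x ])
  deg⁺-snoc-≤ {z} xs x = subst (deg⁺ z xs ≤_) (sym (deg⁺-++ z xs [ x ])) (m≤m+n _ _)

  deg⁺-cons-≤ : ∀ {z} x xs → deg⁺ z xs ≤ deg⁺ z (x ∷ xs)
  deg⁺-cons-≤ {z} x xs = subst (deg⁺ z xs ≤_) (sym (deg⁺-++ z [ x ] xs)) (m≤n+m _ _)

  deg⁺-mono : ∀ {z} (l₁ l₂ : List V) → Unique l₁ → (∀ {y} → y ∈ l₁ → E z y → y ∈ l₂) →
              deg⁺ z l₁ ≤ deg⁺ z l₂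
  deg⁺-mono {z} l₁ l₂ u sub = ⊆-length (filter (arc? z) l₁) (filter (arc? z) l₂)
    (Unique.filter⁺ (arc? z) u)
    (λ p → let (y∈l₁ , e) = ∈-filter⁻ (arc? z) p in ∈-filter⁺ (arc? z) (sub y∈l₁ e) e)

  deg⁺-mono-< : ∀ {z y} (l₁ l₂ : List V) → Unique l₁ → l₁ ⊆ₗ l₂ → y ∈ l₂ → y ∉ l₁ → E z y →
                deg⁺ z l₁ < deg⁺ z l₂
  deg⁺-mono-< {z} l₁ l₂ u sub y∈l₂ y∉l₁ e = ⊆-length-< (filter (arc? z) l₁) (filter (arc? z) l₂)
    (Unique.filter⁺ (arc? z) u)
    (λ p → let (y∈l₁ , e′) = ∈-filter⁻ (arc? z) p in ∈-filter⁺ (arc? z) (sub y∈l₁) e′)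
    (∈-filter⁺ (arc? z) y∈l₂ e) (y∉l₁ ∘ proj₁ ∘ ∈-filter⁻ (arc? z))

  record Admissible (l : List V) : Set where
    field
      unique    : Unique l
      saturated : ∀ {x} → x ∈ l → θ x ≤ deg⁺ x l
      bounded   : ∀ {z} → z ∉ l → deg⁺ z l ≤ θ z

  Runnable : List V → Set
  Runnable xs = Σ (V → ℕ) (Run E θ xs)

  Reachable : Pred V 0ℓ → Set
  Reachable A = Σ (List V) λ xs → Runnable xs × (A ≐ (_∈ xs))

  ∈-snoc⁻ : ∀ {y x : V} xs → y ∈ xs ++ [ x ] → y ∈ xs ⊎ y ≡ x
  ∈-snoc⁻ xs p with ∈-++⁻ xs p
  ... | inj₁ q = inj₁ q
  ... | inj₂ (here e) = inj₂ e

  updated : List V → (V → ℕ) → V → V → ℕ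
  updated xs t x y with em {y ∉ xs × E y x}
  ... | yes _ = t y ∸ 1
  ... | no _ = t y

  updated-correct : ∀ xs t x → Update E xs t x (updated xs t x)
  updated-correct xs t x y with em {y ∉ xs × E y x}
  ... | yes arc = (λ _ → refl) , (λ ¬arc → ⊥-elim (¬arc arc))
  ... | no ¬arc = (λ arc → ⊥-elim (¬arc arc)) , (λ _ → refl)

  erase : ∀ {xs t x} → Run E θ xs t → Erasable E xs t x → Runnable (xs ++ [ x ])
  erase {xs} {t} {x} r er = updated xs t x , step r er (updated-correct xs t x)

  residual : ∀ {xs t} → Run E θ xs t → ∀ {z} → z ∉ xs → t z ≡ θ z ∸ deg⁺ z xs
  residual start _ = refl
  residual (step {xs} {t} {x} {t′} r _ upd) {z} z∉ with em {E z x}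
  ... | yes e = begin
      t′ z                    ≡⟨ proj₁ (upd z) (z∉xs , e) ⟩
      t z ∸ 1                 ≡⟨ cong (_∸ 1) (residual r z∉xs) ⟩
      θ z ∸ deg⁺ z xs ∸ 1     ≡⟨ ∸-+-assoc (θ z) (deg⁺ z xs) 1 ⟩
      θ z ∸ (deg⁺ z xs + 1)   ≡⟨ cong (θ z ∸_) (trans (+-comm (deg⁺ z xs) 1) (sym (deg⁺-snoc-arc xs e))) ⟩
      θ z ∸ deg⁺ z (xs ++ [ x ]) ∎
    where
      open ≡-Reasoning
      z∉xs : z ∉ xs
      z∉xs = z∉ ∘ ∈-++⁺ˡ
  ... | no ¬e = begin
      t′ z                    ≡⟨ proj₂ (upd z) (¬e ∘ proj₂) ⟩
      t z                     ≡⟨ residual r (z∉ ∘ ∈-++⁺ˡ) ⟩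
      θ z ∸ deg⁺ z xs         ≡⟨ cong (θ z ∸_) (sym (deg⁺-snoc-nonarc xs ¬e)) ⟩
      θ z ∸ deg⁺ z (xs ++ [ x ]) ∎
    where open ≡-Reasoning

  run-admissible : ∀ {xs t} → Run E θ xs t → Admissible xs
  run-admissible start = record { unique = [] ; saturated = λ () ; bounded = λ _ → z≤n }
  run-admissible (step {xs} {t} {x} r (x∉xs , tx≡0 , blocked) _) = record
    { unique    = Unique.++⁺ unique ([] ∷ []) (λ { (p , here refl) → x∉xs p })
    ; saturated = saturated′
    ; bounded   = bounded′
    }
    where
      open Admissible (run-admissible r)
      saturated′ : ∀ {y} → y ∈ xs ++ [ x ] → θ y ≤ deg⁺ y (xs ++ [ x ])
      saturated′ p with ∈-snoc⁻ xs p
      ... | inj₁ q = ≤-trans (saturated q) (deg⁺-snoc-≤ xs x)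
      ... | inj₂ refl = ≤-trans (m∸n≡0⇒m≤n (trans (sym (residual r x∉xs)) tx≡0)) (deg⁺-snoc-≤ xs x)
      bounded′ : ∀ {z} → z ∉ xs ++ [ x ] → deg⁺ z (xs ++ [ x ]) ≤ θ z
      bounded′ {z} z∉ with em {E z x}
      ... | yes e = subst (_≤ θ z) (sym (deg⁺-snoc-arc xs e))
                      (m∸n≢0⇒n<m (blocked z (z∉ ∘ ∈-++⁺ˡ) e ∘ trans (residual r (z∉ ∘ ∈-++⁺ˡ))))
      ... | no ¬e = subst (_≤ θ z) (sym (deg⁺-snoc-nonarc xs ¬e)) (bounded (z∉ ∘ ∈-++⁺ˡ))

  -- Among the vertices of B not yet removed, call those whose θ is used up
  -- ready; a sink of the unremoved part of B is ready, and a source of the ready ones is erasable.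
  module Growth {xs t} (run : Run E θ xs t) {B : List V} (admB : Admissible B) (xs⊆B : xs ⊆ₗ B) where
    open Admissible (run-admissible run) using (unique)

    fresh : List V
    fresh = filter (λ y → em {y ∉ xs}) B

    ready? : Decidable (λ y → θ y ≤ deg⁺ y xs)
    ready? y = θ y ≤? deg⁺ y xs

    ready : List V
    ready = filter ready? fresh

    ∈-fresh : ∀ {y} → y ∈ fresh → y ∈ B × y ∉ xs
    ∈-fresh = ∈-filter⁻ (λ y → em {y ∉ xs})

    -- all out-neighbours in B of a sink of fresh were removed, so its θ is used up
    sink-ready : ∀ {s} → s ∈ fresh → (∀ {y} → y ∈ fresh → ¬ E s y) → s ∈ ready
    sink-ready {s} s∈fresh no-arc = ∈-filter⁺ ready? s∈fresh
      (≤-trans (Admissible.saturated admB (proj₁ (∈-fresh s∈fresh)))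
               (deg⁺-mono B xs (Admissible.unique admB) removed))
      where
        removed : ∀ {y} → y ∈ B → E s y → y ∈ xs
        removed {y} y∈B e = decidable-stable em λ y∉xs → no-arc (∈-filter⁺ _ y∈B y∉xs) e

    -- a ready vertex without ready in-neighbours has residual 0 and every unremoved
    -- in-neighbour still has a positive residual
    source-erasable : ∀ {x} → x ∈ ready → (∀ {z} → z ∈ ready → ¬ E z x) → Erasable E xs t x
    source-erasable {x} x∈ready no-arc with ∈-filter⁻ ready? {xs = fresh} x∈ready
    ... | x∈fresh , x-ready with ∈-fresh x∈fresh
    ...   | x∈B , x∉xs =
      x∉xs , trans (residual run x∉xs) (m≤n⇒m∸n≡0 x-ready) ,
      λ z z∉xs e → m>n⇒m∸n≢0 (unfinished z∉xs e) ∘ trans (sym (residual run z∉xs))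
      where
        unfinished : ∀ {z} → z ∉ xs → E z x → deg⁺ z xs < θ z
        unfinished {z} z∉xs e with em {z ∈ B}
        ... | no z∉B = <-≤-trans (deg⁺-mono-< xs B unique xs⊆B x∈B x∉xs e) (Admissible.bounded admB z∉B)
        ... | yes z∈B with ready? z
        ...   | yes z-ready = ⊥-elim (no-arc (∈-filter⁺ ready? (∈-filter⁺ _ z∈B z∉xs) z-ready) e)
        ...   | no z-unready = ≰⇒> z-unready

    growth : ∀ {b} → b ∈ B → b ∉ xs → Σ V λ x → x ∈ B × Erasable E xs t x
    growth b∈B b∉xs with sink E em acyclic fresh (∈-filter⁺ _ b∈B b∉xs)
    ... | s , s∈fresh , s-sink with sink (flip E) em (acyclic-flip E acyclic) ready (sink-ready s∈fresh s-sink)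
    ...   | x , x∈ready , x-source =
      x , proj₁ (∈-fresh (proj₁ (∈-filter⁻ ready? {xs = fresh} x∈ready))) , source-erasable x∈ready x-source

  open Growth using (growth)

  grow-inside : ∀ {B} → Admissible B → ∀ k →
                Σ (List V) λ xs → Runnable xs × xs ⊆ₗ B × (k ≤ length xs ⊎ B ⊆ₗ xs)
  grow-inside admB zero = [] , (θ , start) , (λ ()) , inj₁ z≤n
  grow-inside {B} admB (suc k) with grow-inside admB k
  ... | xs , run , xs⊆B , inj₂ B⊆xs = xs , run , xs⊆B , inj₂ B⊆xs
  ... | xs , (t , r) , xs⊆B , inj₁ k≤ with ⊆-or-missing (_∈ B) (_∈ xs)
  ...   | inj₁ B⊆xs = xs , (t , r) , xs⊆B , inj₂ B⊆xs
  ...   | inj₂ (b , b∈B , b∉xs) with growth r admB xs⊆B b∈B b∉xs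
  ...     | x , x∈B , er = xs ++ [ x ] , erase r er , snoc⊆B ,
                           inj₁ (subst (suc k ≤_) (sym (trans (length-++ xs) (+-comm (length xs) 1))) (s≤s k≤))
    where
      snoc⊆B : xs ++ [ x ] ⊆ₗ B
      snoc⊆B p with ∈-snoc⁻ xs p
      ... | inj₁ q = xs⊆B q
      ... | inj₂ refl = x∈B

  admissible-reachable : ∀ {B} → Admissible B → Reachable (_∈ B)
  admissible-reachable {B} admB with grow-inside admB (suc (length B))
  ... | xs , run , xs⊆B , inj₂ B⊆xs = xs , run , B⊆xs , xs⊆B
  ... | xs , (t , r) , xs⊆B , inj₁ long = ⊥-elim (<-irrefl refl
        (≤-trans long (⊆-length xs B (Admissible.unique (run-admissible r)) xs⊆B)))

  run-prefix : ∀ {xs t} → Run E θ xs t → ∀ k → Runnable (take k xs)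
  run-prefix start zero = θ , start
  run-prefix start (suc k) = θ , start
  run-prefix (step {xs} {t} {x} {t′} r er upd) k with k ≤? length xs
  ... | yes k≤ = subst Runnable (sym (take-++ˡ xs [ x ] k k≤)) (run-prefix r k)
  ... | no k≰ = t′ , subst (λ l → Run E θ l t′) (sym (take-all k (xs ++ [ x ]) long)) (step r er upd)
    where
      long : length (xs ++ [ x ]) ≤ k
      long = subst (_≤ k) (sym (trans (length-++ xs) (+-comm (length xs) 1))) (≰⇒> k≰)

  IS⇒reachable : ∀ {A} → IS E θ A → Reachable A
  IS⇒reachable (finite xs _ r _ , k , _ , A≐) = take k xs , run-prefix r k , A≐
  IS⇒reachable (infinite s runs , k , A≐) = applyUpTo s k , runs k , A≐

  Stuck : List V → (V → ℕ) → Set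
  Stuck xs t = ∀ x → ¬ Erasable E xs t x

  endless : ∀ {xs t} → Run E θ xs t →
            (∀ ys t′ → Run E θ (xs ++ ys) t′ → ¬ Stuck (xs ++ ys) t′) →
            Σ (ℕ → V) λ s → (∀ k → Runnable (applyUpTo s k)) × applyUpTo s (length xs) ≡ xs
  endless {xs} {t} r never-stuck = s , runs , starts-with-xs
    where
      continue : ∀ ys → Runnable (xs ++ ys) → Σ V λ x → Runnable (xs ++ (ys ++ [ x ]))
      continue ys (t′ , r′) with em {Σ V (Erasable E (xs ++ ys) t′)}
      ... | yes (x , er) = x , subst Runnable (++-assoc xs ys [ x ]) (erase r′ er)
      ... | no none = ⊥-elim (never-stuck ys t′ r′ λ x er → none (x , er))
      added : Σ (ℕ → V) λ f → ∀ n → Runnable (xs ++ applyUpTo f n)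
      added = iterate-snoc (Runnable ∘ (xs ++_)) (t , subst (λ l → Run E θ l t) (sym (++-identityʳ xs)) r) continue
      s : ℕ → V
      s = xs ▹ proj₁ added
      runs : ∀ k → Runnable (applyUpTo s k)
      runs k = subst Runnable (take-applyUpTo s k (length xs)) (run-prefix (proj₂ longer) k)
        where
          longer : Runnable (applyUpTo s (k + length xs))
          longer = subst Runnable
            (trans (sym (applyUpTo-▹ xs (proj₁ added) k)) (cong (applyUpTo s) (+-comm (length xs) k)))
                     (proj₂ added k)
      starts-with-xs : applyUpTo s (length xs) ≡ xs
      starts-with-xs = trans (cong (applyUpTo s) (sym (+-identityʳ (length xs))))
                             (trans (applyUpTo-▹ xs (proj₁ added) 0) (++-identityʳ xs))

  -- The vertex set of a run is an initial section: continue the run until it gets stuck,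
  -- or forever if it never does.
  reachable⇒IS : ∀ {A} → Reachable A → IS E θ A
  reachable⇒IS {A} (xs , (t , r) , A≐xs)
    with em {Σ (List V) λ ys → Σ (V → ℕ) λ t′ → Run E θ (xs ++ ys) t′ × Stuck (xs ++ ys) t′}
  ... | yes (ys , t′ , r′ , stuck) =
        finite (xs ++ ys) t′ r′ stuck , length xs , length-++-≤ˡ xs ,
        subst (λ l → A ≐ (_∈ l)) (sym (take-length-++ xs ys)) A≐xs
  ... | no never with endless r (λ ys t′ r′ stuck → never (ys , t′ , r′ , stuck))
  ...   | s , runs , starts-with-xs =
        infinite s runs , length xs , subst (λ l → A ≐ (_∈ l)) (sym starts-with-xs) A≐xs

  size-of-list : ∀ {A : Pred V 0ℓ} {a} {xs : List V} → HasSize A a → Unique xs → A ≐ (_∈ xs) → a ≡ length xs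
  size-of-list (l , u , refl , A≐l) u′ A≐xs =
    same-members-length l _ u u′ (proj₁ A≐xs ∘ proj₂ A≐l) (proj₁ A≐l ∘ proj₂ A≐xs)

  rank-defined : ∀ A → IS E θ A → Σ ℕ (HasSize A)
  rank-defined A isA with IS⇒reachable isA
  ... | xs , (_ , r) , A≐xs = length xs , xs , Admissible.unique (run-admissible r) , refl , A≐xs

  rank-strict : ∀ {A B : Pred V 0ℓ} {a b} → A ⊂ B → HasSize A a → HasSize B b → a < b
  rank-strict (A⊆B , B⊈A) (l₁ , u₁ , refl , A≐l₁) (l₂ , _ , refl , B≐l₂) with missing B⊈A
  ... | y , By , ¬Ay =
    ⊆-length-< l₁ l₂ u₁ (proj₁ B≐l₂ ∘ A⊆B ∘ proj₂ A≐l₁) (proj₁ B≐l₂ By) (¬Ay ∘ proj₂ A≐l₁)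

  -- A cover adds exactly one vertex: by the growth lemma some section lies strictly
  -- between A and B with one more vertex than A, so by minimality it is B.
  rank-cover : ∀ A B a b → Covers (IS E θ) A B → HasSize A a → HasSize B b → b ≡ suc a
  rank-cover A B a b (isA , isB , (A⊆B , B⊈A) , minimal) sizeA sizeB
    with IS⇒reachable isA | IS⇒reachable isB | missing B⊈A
  ... | xs , (t , r) , A≐xs | ys , (_ , rB) , B≐ys | y , By , ¬Ay
    with growth r (run-admissible rB) (proj₁ B≐ys ∘ A⊆B ∘ proj₂ A≐xs) (proj₁ B≐ys By) (¬Ay ∘ proj₂ A≐xs)
  ... | x , x∈ys , er = begin
      b                    ≡⟨ size-of-list sizeB (Admissible.unique (run-admissible (proj₂ runC))) (B⊆C , C⊆B) ⟩
      length (xs ++ [ x ]) ≡⟨ trans (length-++ xs) (+-comm (length xs) 1) ⟩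
      suc (length xs)      ≡⟨ cong suc (sym (size-of-list sizeA (Admissible.unique (run-admissible r)) A≐xs)) ⟩
      suc a                ∎
    where
      open ≡-Reasoning
      C : Pred V 0ℓ
      C v = v ∈ xs ++ [ x ]
      runC : Runnable (xs ++ [ x ])
      runC = erase r er
      C⊆B : C ⊆ B
      C⊆B p with ∈-snoc⁻ xs p
      ... | inj₁ q = A⊆B (proj₂ A≐xs q)
      ... | inj₂ refl = proj₂ B≐ys x∈ys
      A⊂C : A ⊂ C
      A⊂C = ∈-++⁺ˡ ∘ proj₁ A≐xs , λ C⊆A → proj₁ er (proj₁ A≐xs (C⊆A (∈-++⁺ʳ xs (here refl))))
      B⊆C : B ⊆ C
      B⊆C = decidable-stable em λ B⊈C →
              minimal C (reachable⇒IS (xs ++ [ x ] , runC , (λ p → p) , (λ p → p))) A⊂C (C⊆B , B⊈C)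

  graded : GradedByCardinality (IS E θ)
  graded = rank-defined , (λ A B a b _ _ → rank-strict) , rank-cover

  -- Starting from the union of F, keep adding vertices of K having more than θ
  -- out-neighbours present.  Each added vertex lies in every reachable upper bound U of F
  -- (U is admissible), and the final list is admissible, hence the least upper bound.
  module Join (K : List V) (admK : Admissible K) (F : Pred (Pred V 0ℓ) (lsuc 0ℓ))
              (F-reachable : ∀ A → F A → Reachable A) (F⊆K : ∀ A → F A → ∀ {v} → A v → v ∈ K) where

    UpperBound : Pred V 0ℓ → Set₁
    UpperBound U = Reachable U × (∀ A → F A → A ⊆ U)

    -- invariant of the saturation process
    record Approximant (X : List V) : Set₁ where
      field
        unique    : Unique X
        inside    : X ⊆ₗ K
        saturated : ∀ {x} → x ∈ X → θ x ≤ deg⁺ x X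
        contains  : ∀ A → F A → ∀ {v} → A v → v ∈ X
        below     : ∀ U → UpperBound U → ∀ {v} → v ∈ X → U v

    Closed : List V → Set
    Closed X = ∀ {z} → z ∈ K → z ∉ X → deg⁺ z X ≤ θ z

    -- an overfull vertex of K belongs to every reachable upper bound, so adding it is safe
    add-overfull : ∀ {X z} → Approximant X → z ∈ K → z ∉ X → θ z < deg⁺ z X → Approximant (z ∷ X)
    add-overfull {X} {z} apx z∈K z∉X overfull = record
      { unique    = ¬Any⇒All¬ X z∉X ∷ unique
      ; inside    = λ { (here refl) → z∈K ; (there p) → inside p }
      ; saturated = λ { (here refl) → ≤-trans (<⇒≤ overfull) (deg⁺-cons-≤ z X)
                      ; (there p) → ≤-trans (saturated p) (deg⁺-cons-≤ z X) }
      ; contains  = λ A FA Av → there (contains A FA Av)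
      ; below     = below′
      }
      where
        open Approximant apx
        below′ : ∀ U → UpperBound U → ∀ {v} → v ∈ z ∷ X → U v
        below′ U upper (there p) = below U upper p
        below′ U upper@((l , (_ , rU) , U≐l) , _) (here refl) = decidable-stable em λ ¬Uz →
          <-irrefl refl (<-≤-trans overfull (≤-trans
            (deg⁺-mono X l unique (λ p _ → proj₁ U≐l (below U upper p)))
            (Admissible.bounded (run-admissible rU) (¬Uz ∘ proj₂ U≐l))))

    -- saturation terminates since each round adds a new vertex of K
    saturate : ∀ n X → Approximant X → length K ≤ length X + n → Σ (List V) λ Y → Approximant Y × Closed Y
    saturate n X apx fuel with em {Σ V λ z → z ∈ K × z ∉ X × θ z < deg⁺ z X}
    ... | no none = X , apx , λ z∈K z∉X → ≮⇒≥ (λ overfull → none (_ , z∈K , z∉X , overfull))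
    saturate zero X apx fuel | yes (z , z∈K , z∉X , _) = ⊥-elim (<-irrefl refl
      (<-≤-trans (⊆-length-< X K (Approximant.unique apx) (Approximant.inside apx) z∈K z∉X)
                 (subst (length K ≤_) (+-identityʳ _) fuel)))
    saturate (suc n) X apx fuel | yes (z , z∈K , z∉X , overfull) =
      saturate n (z ∷ X) (add-overfull apx z∈K z∉X overfull) (subst (length K ≤_) (+-suc (length X) n) fuel)

    inF? : Decidable (λ v → Σ (Pred V 0ℓ) λ A → F A × A v)
    inF? v = lem (lsuc 0ℓ)

    union : List V
    union = filter inF? K

    union-approximant : Approximant union
    union-approximant = record
      { unique    = Unique.filter⁺ inF? (Admissible.unique admK)
      ; inside    = proj₁ ∘ ∈-filter⁻ inF? {xs = K}
      ; saturated = saturated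
      ; contains  = λ A FA Av → ∈-filter⁺ inF? (F⊆K A FA Av) (A , FA , Av)
      ; below     = λ U upper p → let (A , FA , Av) = proj₂ (∈-filter⁻ inF? {xs = K} p) in proj₂ upper A FA Av
      }
      where
        saturated : ∀ {v} → v ∈ union → θ v ≤ deg⁺ v union
        saturated p with proj₂ (∈-filter⁻ inF? {xs = K} p)
        ... | A , FA , Av with F-reachable A FA
        ...   | l , (_ , r) , A≐l = ≤-trans (Admissible.saturated (run-admissible r) (proj₁ A≐l Av))
                  (deg⁺-mono l union (Admissible.unique (run-admissible r))
                    (λ q _ → ∈-filter⁺ inF? (F⊆K A FA (proj₂ A≐l q)) (A , FA , proj₂ A≐l q)))

    closure : Σ (List V) λ Y → Approximant Y × Closed Y
    closure = saturate (length K) union union-approximant (m≤n+m (length K) (length union))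

    Y : List V
    Y = proj₁ closure

    open Approximant (proj₁ (proj₂ closure))

    -- outside K the bound on deg⁺ is inherited from the admissibility of K
    closure-admissible : Admissible Y
    closure-admissible = record { unique = unique ; saturated = saturated ; bounded = bounded }
      where
        bounded : ∀ {z} → z ∉ Y → deg⁺ z Y ≤ θ z
        bounded {z} z∉Y with em {z ∈ K}
        ... | yes z∈K = proj₂ (proj₂ closure) z∈K z∉Y
        ... | no z∉K = ≤-trans (deg⁺-mono Y K unique (λ p _ → inside p)) (Admissible.bounded admK z∉K)

    join : Σ (Pred V 0ℓ) λ M → Reachable M × (∀ A → F A → A ⊆ M) × (∀ U → UpperBound U → M ⊆ U)
    join = (_∈ Y) , admissible-reachable closure-admissible , contains , below

  -- The infimum of S is the join of its lower bounds, provided they all lie in an admissible K.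
  infimum-below : (K : List V) → Admissible K → (S : Pred (Pred V 0ℓ) (lsuc 0ℓ)) → SubsetOf (IS E θ) S →
                  (∀ L → IsLowerBound (IS E θ) S L → ∀ {v} → L v → v ∈ K) →
                  Σ (Pred V 0ℓ) (IsInfimum (IS E θ) S)
  infimum-below K admK S S⊆IS lower⊆K
    with Join.join K admK (IsLowerBound (IS E θ) S) (λ L lower → IS⇒reachable (proj₁ lower)) lower⊆K
  ... | M , reachM , lower⊆M , M⊆upper = M , (reachable⇒IS reachM , M⊆members) , lower⊆M
    where
      -- each member of S is a reachable upper bound of the lower bounds
      M⊆members : ∀ A → S A → M ⊆ A
      M⊆members A SA = M⊆upper A (IS⇒reachable (S⊆IS A SA) , λ L lower → proj₂ lower A SA)

  -- Every lower bound of a nonempty S lies in a member of S, which is admissible.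
  meet : CompleteMeetSemilattice (IS E θ)
  meet S S⊆IS (A₀ , SA₀) with IS⇒reachable (S⊆IS A₀ SA₀)
  ... | l₀ , (_ , r₀) , A₀≐l₀ =
    infimum-below l₀ (run-admissible r₀) S S⊆IS (λ L lower → proj₁ A₀≐l₀ ∘ proj₂ lower A₀ SA₀)

  -- When V is finite, the list of all vertices is admissible: θ is at most the out-degree.
  all-vertices-admissible : FiniteType V → Σ (List V) λ K → Admissible K × (∀ {v} → v ∈ K)
  all-vertices-admissible (n , V↔Fin) = all , all-admissible , everything
    where
      open Inverse V↔Fin
      all : List V
      all = tabulate from
      everything : ∀ {v} → v ∈ all
      everything {v} = subst (_∈ all) (strictlyInverseʳ v) (∈-tabulate⁺ (to v))
      from-injective : ∀ {i j} → from i ≡ from j → i ≡ j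
      from-injective {i} {j} e = trans (sym (strictlyInverseˡ i)) (trans (cong to e) (strictlyInverseˡ j))
      out-degree-bound : ∀ x → θ x ≤ deg⁺ x all
      out-degree-bound x with proj₂ valued x
      ... | g , g-injective , g-arcs = subst (_≤ deg⁺ x all) (length-tabulate g)
              (⊆-length (tabulate g) (filter (arc? x) all) (Unique.tabulate⁺ g-injective)
                (λ p → let (i , eq) = ∈-tabulate⁻ p in
                  ∈-filter⁺ (arc? x) everything (subst (E x) (sym eq) (g-arcs i))))
      all-admissible : Admissible all
      all-admissible = record
        { unique    = Unique.tabulate⁺ from-injective
        ; saturated = λ {x} _ → out-degree-bound x
        ; bounded   = λ z∉all → ⊥-elim (z∉all everything)
        }

  lattice : FiniteType V → CompleteLattice (IS E θ)
  lattice finite-V S S⊆IS with all-vertices-admissible finite-V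
  ... | K , admK , everything
    with Join.join K admK S (λ A SA → IS⇒reachable (S⊆IS A SA)) (λ _ _ _ → everything)
  ...   | M , reachM , S⊆M , M⊆upper =
    infimum-below K admK S S⊆IS (λ _ _ _ → everything) ,
    (M , (reachable⇒IS reachM , S⊆M) , λ U (isU , S⊆U) → M⊆upper U (IS⇒reachable isU , S⊆U))

theorem1 : {V : Set} (E : V → V → Set) (θ : V → ℕ) →
    IsValuedDigraph E θ →
    ((ℓ : Level) → ExcludedMiddle ℓ) →
    (CompleteMeetSemilattice (IS E θ) × GradedByCardinality (IS E θ)) ×
    (FiniteType V → CompleteLattice (IS E θ))
theorem1 E θ valued lem = (meet , graded) , lattice
  where open Peeling E θ valued lem
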